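{- For all terms $s,t$ over $\Sigma_{SCL}(A)$ (with variables), $\mathrm{EqSSCL}\vdash s=t$ if and only if $\mathrm{SSCL}\vdash s=t$.
   Context: $A$ is a non-empty set of atoms; $\Sigma_{SCL}(A)=\{\land_s,\lor_s,\neg,\mathsf T,\mathsf F\}\cup A$; $\vdash$ is equational-logic derivability. $\mathrm{EqSSCL}$ consists of (Neg) $\mathsf F=\neg\mathsf T$, (Or) $x\lor_s y=\neg(\neg x\land_s\neg y)$, (Tand) $\mathsf T\land_s x=x$, (Abs) $x\land_s(x\lor_s y)=x$, (Mem) $(x\lor_s y)\land_s z=(\neg x\land_s(y\land_s z))\lor_s(x\land_s z)$, (Comm) $x\land_s y=y\land_s x$. Static short-circuit logic: $\mathrm{SSCL}\vdash s=t$ means $s=t$ is derivable from the following equations over $\Sigma_{SCL}(A)$ extended with Hoare's conditional $x\lhd y\rhd z$ (a hidden operator): (CP1) $x\lhd\mathsf T\rhd y=x$, (CP2) $x\lhd\mathsf F\rhd y=y$, (CP3) $\mathsf T\lhd x\rhd\mathsf F=x$, (CP4) $x\lhd(y\lhd z\rhd u)\rhd v=(x\lhd y\rhd v)\lhd z\rhd(x\lhd u\rhd v)$, (CPmem) $x\lhd y\rhd(z\lhd u\rhd(v\lhd y\rhd w))=x\lhd y\rhd(z\lhd u\rhd w)$, (CPs) $\mathsf F\lhd x\rhd\mathsf F=\mathsf F$, and $\neg x=\mathsf F\lhd x\rhd\mathsf T$, $x\land_s y=y\lhd x\rhd\mathsf F$, $x\lor_s y=\mathsf T\lhd x\rhd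 y$. -}

module Defs where

open import Data.Nat using (ℕ)

data Term (A : Set) : Set where
  var  : ℕ → Term A
  atom : A → Term A
  𝐓 𝐅  : Term A
  ¬ₛ_  : Term A → Term A
  _∧ₛ_ : Term A → Term A → Term A
  _∨ₛ_ : Term A → Term A → Term A

-- Terms over Σ_SCL(A) extended with Hoare's conditional  x ◁ y ▷ z.
data CTerm (A : Set) : Set where
  var  : ℕ → CTerm A
  atom : A → CTerm A
  𝐓 𝐅  : CTerm A
  ¬ₛ_  : CTerm A → CTerm A
  _∧ₛ_ : CTerm A → CTerm A → CTerm A
  _∨ₛ_ : CTerm A → CTerm A → CTerm A
  _◁_▷_ : CTerm A → CTerm A → CTerm A → CTerm A

emb : {A : Set} → Term A → CTerm A
emb (var n)   = var n
emb (atom a)  = atom a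
emb 𝐓         = 𝐓
emb 𝐅         = 𝐅
emb (¬ₛ x)    = ¬ₛ emb x
emb (x ∧ₛ y)  = emb x ∧ₛ emb y
emb (x ∨ₛ y)  = emb x ∨ₛ emb y

-- Equational-logic derivability from EqSSCL.  Axioms are given as schemes
-- (all substitution instances), closed under equivalence and congruence.
data EqSSCL⊢_≈_ {A : Set} : Term A → Term A → Set where
  Neg  : EqSSCL⊢ 𝐅 ≈ (¬ₛ 𝐓)
  Or   : ∀ x y → EqSSCL⊢ (x ∨ₛ y) ≈ (¬ₛ ((¬ₛ x) ∧ₛ (¬ₛ y)))
  Tand : ∀ x → EqSSCL⊢ (𝐓 ∧ₛ x) ≈ x
  Abs  : ∀ x y → EqSSCL⊢ (x ∧ₛ (x ∨ₛ y)) ≈ x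
  Mem  : ∀ x y z → EqSSCL⊢ ((x ∨ₛ y) ∧ₛ z) ≈ (((¬ₛ x) ∧ₛ (y ∧ₛ z)) ∨ₛ (x ∧ₛ z))
  Comm : ∀ x y → EqSSCL⊢ (x ∧ₛ y) ≈ (y ∧ₛ x)
  refl  : ∀ {x} → EqSSCL⊢ x ≈ x
  sym   : ∀ {x y} → EqSSCL⊢ x ≈ y → EqSSCL⊢ y ≈ x
  trans : ∀ {x y z} → EqSSCL⊢ x ≈ y → EqSSCL⊢ y ≈ z → EqSSCL⊢ x ≈ z
  cong¬ : ∀ {x x'} → EqSSCL⊢ x ≈ x' → EqSSCL⊢ (¬ₛ x) ≈ (¬ₛ x')
  cong∧ : ∀ {x x' y y'} → EqSSCL⊢ x ≈ x' → EqSSCL⊢ y ≈ y' → EqSSCL⊢ (x ∧ₛ y) ≈ (x' ∧ₛ y')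
  cong∨ : ∀ {x x' y y'} → EqSSCL⊢ x ≈ x' → EqSSCL⊢ y ≈ y' → EqSSCL⊢ (x ∨ₛ y) ≈ (x' ∨ₛ y')

data SSCL⊢_≈_ {A : Set} : CTerm A → CTerm A → Set where
  CP1   : ∀ x y → SSCL⊢ (x ◁ 𝐓 ▷ y) ≈ x
  CP2   : ∀ x y → SSCL⊢ (x ◁ 𝐅 ▷ y) ≈ y
  CP3   : ∀ x → SSCL⊢ (𝐓 ◁ x ▷ 𝐅) ≈ x
  CP4   : ∀ x y z u v →
          SSCL⊢ (x ◁ (y ◁ z ▷ u) ▷ v) ≈ ((x ◁ y ▷ v) ◁ z ▷ (x ◁ u ▷ v))
  CPmem : ∀ x y z u v w →
          SSCL⊢ (x ◁ y ▷ (z ◁ u ▷ (v ◁ y ▷ w))) ≈ (x ◁ y ▷ (z ◁ u ▷ w))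
  CPs   : ∀ x → SSCL⊢ (𝐅 ◁ x ▷ 𝐅) ≈ 𝐅
  Def¬  : ∀ x → SSCL⊢ (¬ₛ x) ≈ (𝐅 ◁ x ▷ 𝐓)
  Def∧  : ∀ x y → SSCL⊢ (x ∧ₛ y) ≈ (y ◁ x ▷ 𝐅)
  Def∨  : ∀ x y → SSCL⊢ (x ∨ₛ y) ≈ (𝐓 ◁ x ▷ y)
  refl  : ∀ {x} → SSCL⊢ x ≈ x
  sym   : ∀ {x y} → SSCL⊢ x ≈ y → SSCL⊢ y ≈ x
  trans : ∀ {x y z} → SSCL⊢ x ≈ y → SSCL⊢ y ≈ z → SSCL⊢ x ≈ z
  cong¬ : ∀ {x x'} → SSCL⊢ x ≈ x' → SSCL⊢ (¬ₛ x) ≈ (¬ₛ x')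
  cong∧ : ∀ {x x' y y'} → SSCL⊢ x ≈ x' → SSCL⊢ y ≈ y' → SSCL⊢ (x ∧ₛ y) ≈ (x' ∧ₛ y')
  cong∨ : ∀ {x x' y y'} → SSCL⊢ x ≈ x' → SSCL⊢ y ≈ y' → SSCL⊢ (x ∨ₛ y) ≈ (x' ∨ₛ y')
  cong◁▷ : ∀ {x x' y y' z z'} → SSCL⊢ x ≈ x' → SSCL⊢ y ≈ y' → SSCL⊢ z ≈ z' →
           SSCL⊢ (x ◁ y ▷ z) ≈ (x' ◁ y' ▷ z')

module Submission where

-- Both systems axiomatise Boolean algebra: the terms modulo EqSSCL, and the
-- conditional terms modulo SSCL, each satisfy a small set of Boolean-algebra
-- laws (commutativity, distributivity, unit and complement of ∧, involution
-- and De Morgan), from which the full lattice axioms follow by duality and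
-- a cancellation argument.  In every Boolean algebra an equation between
-- Boolean expressions holds as soon as it holds in the two-element algebra
-- (induction on the number of variables via Shannon expansion), and this is
-- decidable by truth tables.  Hence every EqSSCL axiom is an SSCL-theorem,
-- which gives soundness of the embedding; and every SSCL axiom, after
-- eliminating the conditional via  x ◁ y ▷ z = (y ∧ x) ∨ (¬ y ∧ z),  is an
-- EqSSCL-theorem, which together with  eliminate (emb s) ≡ s  gives the
-- converse.

open import Defs hiding (refl; sym; trans)
open import Level using (0ℓ; _⊔_) renaming (suc to lsuc)
open import Algebra.Core using (Op₁; Op₂)
open import Algebra.Consequences.Setoid using (comm∧distrˡ⇒distrʳ)
open import Algebra.Lattice.Bundles using (BooleanAlgebra)
open import Algebra.Lattice.Structures.Biased using (isBooleanAlgebraʳ; isDistributiveLatticeʳʲᵐ)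
import Algebra.Lattice.Properties.BooleanAlgebra as BooleanAlgebraProperties
open import Data.Bool using (Bool; true; false)
open import Data.Bool.Properties using (_≟_; ∨-∧-booleanAlgebra)
open import Data.Fin using (Fin; zero; suc)
open import Data.Nat using (ℕ; zero; suc; _+_)
open import Data.Product using (_×_; _,_)
open import Data.Vec using (Vec; []; _∷_; lookup; map)
open import Data.Vec.Properties using (lookup-map)
open import Relation.Binary.Core using (Rel)
open import Relation.Binary.Bundles using (Setoid)
open import Relation.Binary.Structures using (IsEquivalence)
open import Relation.Binary.PropositionalEquality as ≡ using (_≡_)
import Relation.Binary.Reasoning.Setoid as SetoidReasoning
open import Relation.Nullary using (Dec; _×-dec_)
open import Relation.Nullary.Decidable using (True; toWitness; map′)

-- A Boolean algebra presented by a one-sided set of laws: congruence plus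
-- six equations, chosen to be easy to verify in the two term models below.
record MinimalBooleanAlgebra c ℓ : Set (lsuc (c ⊔ ℓ)) where
  infix  8 ¬_
  infixr 7 _∧_
  infixr 6 _∨_
  infix  4 _≈_
  field
    Carrier       : Set c
    _≈_           : Rel Carrier ℓ
    _∨_ _∧_       : Op₂ Carrier
    ¬_            : Op₁ Carrier
    ⊤ ⊥           : Carrier
    isEquivalence : IsEquivalence _≈_
    ∨-cong        : ∀ {x y u v} → x ≈ y → u ≈ v → x ∨ u ≈ y ∨ v
    ∧-cong        : ∀ {x y u v} → x ≈ y → u ≈ v → x ∧ u ≈ y ∧ v
    ¬-cong        : ∀ {x y} → x ≈ y → ¬ x ≈ ¬ y
    ∧-comm        : ∀ x y → x ∧ y ≈ y ∧ x
    ∧-distribˡ-∨  : ∀ x y z → x ∧ (y ∨ z) ≈ (x ∧ y) ∨ (x ∧ z)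
    ∧-identityʳ   : ∀ x → x ∧ ⊤ ≈ x
    ∧-complementʳ : ∀ x → x ∧ ¬ x ≈ ⊥
    ¬-involutive  : ∀ x → ¬ ¬ x ≈ x
    deMorgan₂     : ∀ x y → ¬ (x ∨ y) ≈ ¬ x ∧ ¬ y

  open IsEquivalence isEquivalence public

  setoid : Setoid c ℓ
  setoid = record { isEquivalence = isEquivalence }

module Duality {c ℓ} (M : MinimalBooleanAlgebra c ℓ) where
  open MinimalBooleanAlgebra M
  open SetoidReasoning setoid

  ∧-identityˡ : ∀ x → ⊤ ∧ x ≈ x
  ∧-identityˡ x = trans (∧-comm ⊤ x) (∧-identityʳ x)

  ¬⊤≈⊥ : ¬ ⊤ ≈ ⊥
  ¬⊤≈⊥ = trans (sym (∧-identityˡ (¬ ⊤))) (∧-complementʳ ⊤)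

  ¬⊥≈⊤ : ¬ ⊥ ≈ ⊤
  ¬⊥≈⊤ = trans (¬-cong (sym ¬⊤≈⊥)) (¬-involutive ⊤)

  ∨-by-∧ : ∀ x y → x ∨ y ≈ ¬ (¬ x ∧ ¬ y)
  ∨-by-∧ x y = trans (sym (¬-involutive (x ∨ y))) (¬-cong (deMorgan₂ x y))

  deMorgan₁ : ∀ x y → ¬ (x ∧ y) ≈ ¬ x ∨ ¬ y
  deMorgan₁ x y = begin
    ¬ (x ∧ y)         ≈⟨ ¬-cong (∧-cong (¬-involutive x) (¬-involutive y)) ⟨
    ¬ (¬ ¬ x ∧ ¬ ¬ y) ≈⟨ ∨-by-∧ (¬ x) (¬ y) ⟨
    ¬ x ∨ ¬ y         ∎

  ∨-comm : ∀ x y → x ∨ y ≈ y ∨ x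
  ∨-comm x y = begin
    x ∨ y           ≈⟨ ∨-by-∧ x y ⟩
    ¬ (¬ x ∧ ¬ y)   ≈⟨ ¬-cong (∧-comm (¬ x) (¬ y)) ⟩
    ¬ (¬ y ∧ ¬ x)   ≈⟨ ∨-by-∧ y x ⟨
    y ∨ x           ∎

  ∨-distribˡ-∧ : ∀ x y z → x ∨ (y ∧ z) ≈ (x ∨ y) ∧ (x ∨ z)
  ∨-distribˡ-∧ x y z = begin
    x ∨ (y ∧ z)                       ≈⟨ ∨-by-∧ x (y ∧ z) ⟩
    ¬ (¬ x ∧ ¬ (y ∧ z))               ≈⟨ ¬-cong (∧-cong refl (deMorgan₁ y z)) ⟩
    ¬ (¬ x ∧ (¬ y ∨ ¬ z))             ≈⟨ ¬-cong (∧-distribˡ-∨ (¬ x) (¬ y) (¬ z)) ⟩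
    ¬ ((¬ x ∧ ¬ y) ∨ (¬ x ∧ ¬ z))     ≈⟨ ¬-cong (∨-cong (deMorgan₂ x y) (deMorgan₂ x z)) ⟨
    ¬ (¬ (x ∨ y) ∨ ¬ (x ∨ z))         ≈⟨ deMorgan₂ (¬ (x ∨ y)) (¬ (x ∨ z)) ⟩
    ¬ ¬ (x ∨ y) ∧ ¬ ¬ (x ∨ z)         ≈⟨ ∧-cong (¬-involutive (x ∨ y)) (¬-involutive (x ∨ z)) ⟩
    (x ∨ y) ∧ (x ∨ z)                 ∎

  ∨-identityʳ : ∀ x → x ∨ ⊥ ≈ x
  ∨-identityʳ x = begin
    x ∨ ⊥           ≈⟨ ∨-by-∧ x ⊥ ⟩
    ¬ (¬ x ∧ ¬ ⊥)   ≈⟨ ¬-cong (∧-cong refl ¬⊥≈⊤) ⟩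
    ¬ (¬ x ∧ ⊤)     ≈⟨ ¬-cong (∧-identityʳ (¬ x)) ⟩
    ¬ ¬ x           ≈⟨ ¬-involutive x ⟩
    x               ∎

  ∨-complementʳ : ∀ x → x ∨ ¬ x ≈ ⊤
  ∨-complementʳ x = begin
    x ∨ ¬ x         ≈⟨ ∨-by-∧ x (¬ x) ⟩
    ¬ (¬ x ∧ ¬ ¬ x) ≈⟨ ¬-cong (∧-complementʳ (¬ x)) ⟩
    ¬ ⊥             ≈⟨ ¬⊥≈⊤ ⟩
    ⊤               ∎

  dual : MinimalBooleanAlgebra c ℓ
  dual = record
    { Carrier       = Carrier
    ; _≈_           = _≈_
    ; _∨_           = _∧_
    ; _∧_           = _∨_
    ; ¬_            = ¬_
    ; ⊤             = ⊥
    ; ⊥             = ⊤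
    ; isEquivalence = isEquivalence
    ; ∨-cong        = ∧-cong
    ; ∧-cong        = ∨-cong
    ; ¬-cong        = ¬-cong
    ; ∧-comm        = ∨-comm
    ; ∧-distribˡ-∨  = ∨-distribˡ-∧
    ; ∧-identityʳ   = ∨-identityʳ
    ; ∧-complementʳ = ∨-complementʳ
    ; ¬-involutive  = ¬-involutive
    ; deMorgan₂     = deMorgan₁
    }

-- The zero and absorption laws for ∨; their ∧-versions are the same
-- lemmas applied to the dual algebra.
module Absorption {c ℓ} (M : MinimalBooleanAlgebra c ℓ) where
  open MinimalBooleanAlgebra M
  open Duality M
  open SetoidReasoning setoid

  ∨-zeroʳ : ∀ x → x ∨ ⊤ ≈ ⊤
  ∨-zeroʳ x = begin
    x ∨ ⊤               ≈⟨ ∧-identityʳ (x ∨ ⊤) ⟨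
    (x ∨ ⊤) ∧ ⊤         ≈⟨ ∧-cong refl (∨-complementʳ x) ⟨
    (x ∨ ⊤) ∧ (x ∨ ¬ x) ≈⟨ ∨-distribˡ-∧ x ⊤ (¬ x) ⟨
    x ∨ (⊤ ∧ ¬ x)       ≈⟨ ∨-cong refl (∧-identityˡ (¬ x)) ⟩
    x ∨ ¬ x             ≈⟨ ∨-complementʳ x ⟩
    ⊤                   ∎

  ∨-absorbs-∧ : ∀ x y → x ∨ (x ∧ y) ≈ x
  ∨-absorbs-∧ x y = begin
    x ∨ (x ∧ y)         ≈⟨ ∨-cong (∧-identityʳ x) refl ⟨
    (x ∧ ⊤) ∨ (x ∧ y)   ≈⟨ ∧-distribˡ-∨ x ⊤ y ⟨
    x ∧ (⊤ ∨ y)         ≈⟨ ∧-cong refl (trans (∨-comm ⊤ y) (∨-zeroʳ y)) ⟩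
    x ∧ ⊤               ≈⟨ ∧-identityʳ x ⟩
    x                   ∎

-- Associativity of ∧, by cancellation: an element l is determined by the
-- two joins a ∨ l and ¬ a ∨ l.
module Associativity {c ℓ} (M : MinimalBooleanAlgebra c ℓ) where
  open MinimalBooleanAlgebra M
  open Duality M
  open Absorption M
  open Absorption dual using () renaming (∨-absorbs-∧ to ∧-absorbs-∨)
  open SetoidReasoning setoid

  cancel : ∀ a l r → a ∨ l ≈ a ∨ r → ¬ a ∨ l ≈ ¬ a ∨ r → l ≈ r
  cancel a l r a∨l≈a∨r ¬a∨l≈¬a∨r = begin
    l                       ≈⟨ split l ⟩
    (a ∨ l) ∧ (¬ a ∨ l)     ≈⟨ ∧-cong a∨l≈a∨r ¬a∨l≈¬a∨r ⟩
    (a ∨ r) ∧ (¬ a ∨ r)     ≈⟨ split r ⟨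
    r                       ∎
    where
    split : ∀ l → l ≈ (a ∨ l) ∧ (¬ a ∨ l)
    split l = begin
      l                     ≈⟨ ∨-identityʳ l ⟨
      l ∨ ⊥                 ≈⟨ ∨-cong refl (∧-complementʳ a) ⟨
      l ∨ (a ∧ ¬ a)         ≈⟨ ∨-distribˡ-∧ l a (¬ a) ⟩
      (l ∨ a) ∧ (l ∨ ¬ a)   ≈⟨ ∧-cong (∨-comm l a) (∨-comm l (¬ a)) ⟩
      (a ∨ l) ∧ (¬ a ∨ l)   ∎

  ¬-∨-∧ : ∀ a w → ¬ a ∨ (a ∧ w) ≈ ¬ a ∨ w
  ¬-∨-∧ a w = begin
    ¬ a ∨ (a ∧ w)           ≈⟨ ∨-distribˡ-∧ (¬ a) a w ⟩
    (¬ a ∨ a) ∧ (¬ a ∨ w)   ≈⟨ ∧-cong (trans (∨-comm (¬ a) a) (∨-complementʳ a)) refl ⟩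
    ⊤ ∧ (¬ a ∨ w)           ≈⟨ ∧-identityˡ (¬ a ∨ w) ⟩
    ¬ a ∨ w                 ∎

  ∧-assoc : ∀ x y z → (x ∧ y) ∧ z ≈ x ∧ (y ∧ z)
  ∧-assoc x y z = cancel x ((x ∧ y) ∧ z) (x ∧ (y ∧ z))
    (trans below-x (sym (∨-absorbs-∧ x (y ∧ z))))
    (trans below-¬x (sym (¬-∨-∧ x (y ∧ z))))
    where
    below-x : x ∨ ((x ∧ y) ∧ z) ≈ x
    below-x = begin
      x ∨ ((x ∧ y) ∧ z)         ≈⟨ ∨-distribˡ-∧ x (x ∧ y) z ⟩
      (x ∨ (x ∧ y)) ∧ (x ∨ z)   ≈⟨ ∧-cong (∨-absorbs-∧ x y) refl ⟩
      x ∧ (x ∨ z)               ≈⟨ ∧-absorbs-∨ x z ⟩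
      x                         ∎
    below-¬x : ¬ x ∨ ((x ∧ y) ∧ z) ≈ ¬ x ∨ (y ∧ z)
    below-¬x = begin
      ¬ x ∨ ((x ∧ y) ∧ z)             ≈⟨ ∨-distribˡ-∧ (¬ x) (x ∧ y) z ⟩
      (¬ x ∨ (x ∧ y)) ∧ (¬ x ∨ z)     ≈⟨ ∧-cong (¬-∨-∧ x y) refl ⟩
      (¬ x ∨ y) ∧ (¬ x ∨ z)           ≈⟨ ∨-distribˡ-∧ (¬ x) y z ⟨
      ¬ x ∨ (y ∧ z)                   ∎

booleanAlgebra : ∀ {c ℓ} → MinimalBooleanAlgebra c ℓ → BooleanAlgebra c ℓ
booleanAlgebra M = record
  { isBooleanAlgebra = isBooleanAlgebraʳ record
    { isDistributiveLattice = isDistributiveLatticeʳʲᵐ record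
      { isLattice = record
        { isEquivalence = isEquivalence
        ; ∨-comm        = ∨-comm
        ; ∨-assoc       = Associativity.∧-assoc dual
        ; ∨-cong        = ∨-cong
        ; ∧-comm        = ∧-comm
        ; ∧-assoc       = Associativity.∧-assoc M
        ; ∧-cong        = ∧-cong
        ; absorptive    = Absorption.∨-absorbs-∧ M , Absorption.∨-absorbs-∧ dual
        }
      ; ∨-distribʳ-∧ = comm∧distrˡ⇒distrʳ setoid ∧-cong ∨-comm ∨-distribˡ-∧
      }
    ; ∨-complementʳ = ∨-complementʳ
    ; ∧-complementʳ = ∧-complementʳ
    ; ¬-cong        = ¬-cong
    }
  }
  where
  open MinimalBooleanAlgebra M
  open Duality M

data Expr (n : ℕ) : Set where
  var   : Fin n → Expr n
  const : Bool → Expr n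
  ¬ᵉ_   : Expr n → Expr n
  _∧ᵉ_  : Expr n → Expr n → Expr n
  _∨ᵉ_  : Expr n → Expr n → Expr n

infix  8 ¬ᵉ_
infixr 7 _∧ᵉ_
infixr 6 _∨ᵉ_

pattern ⊤ᵉ = const true
pattern ⊥ᵉ = const false

_[_] : ∀ {n} → Expr (suc n) → Expr n → Expr n
var zero    [ c ] = c
var (suc i) [ c ] = var i
const b     [ c ] = const b
(¬ᵉ e)      [ c ] = ¬ᵉ (e [ c ])
(e ∧ᵉ f)    [ c ] = (e [ c ]) ∧ᵉ (f [ c ])
(e ∨ᵉ f)    [ c ] = (e [ c ]) ∨ᵉ (f [ c ])

module Semantics {c ℓ} (B : BooleanAlgebra c ℓ) where
  open BooleanAlgebra B

  bool : Bool → Carrier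
  bool true  = ⊤
  bool false = ⊥

  ⟦_⟧ : ∀ {n} → Expr n → Vec Carrier n → Carrier
  ⟦ var i   ⟧ ρ = lookup ρ i
  ⟦ const b ⟧ ρ = bool b
  ⟦ ¬ᵉ e    ⟧ ρ = ¬ ⟦ e ⟧ ρ
  ⟦ e ∧ᵉ f  ⟧ ρ = ⟦ e ⟧ ρ ∧ ⟦ f ⟧ ρ
  ⟦ e ∨ᵉ f  ⟧ ρ = ⟦ e ⟧ ρ ∨ ⟦ f ⟧ ρ

  substitution : ∀ {n} (e : Expr (suc n)) c ρ → ⟦ e [ c ] ⟧ ρ ≡ ⟦ e ⟧ (⟦ c ⟧ ρ ∷ ρ)
  substitution (var zero)    c ρ = ≡.refl
  substitution (var (suc i)) c ρ = ≡.refl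
  substitution (const b)     c ρ = ≡.refl
  substitution (¬ᵉ e)        c ρ = ≡.cong ¬_ (substitution e c ρ)
  substitution (e ∧ᵉ f)      c ρ = ≡.cong₂ _∧_ (substitution e c ρ) (substitution f c ρ)
  substitution (e ∨ᵉ f)      c ρ = ≡.cong₂ _∨_ (substitution e c ρ) (substitution f c ρ)

open Semantics ∨-∧-booleanAlgebra
  using () renaming (⟦_⟧ to ⟦_⟧₂; substitution to substitution₂)

Tautology : ∀ {n} → Expr n → Expr n → Set
Tautology {n} e₁ e₂ = ∀ (σ : Vec Bool n) → ⟦ e₁ ⟧₂ σ ≡ ⟦ e₂ ⟧₂ σ

all? : ∀ n {P : Vec Bool n → Set} → (∀ σ → Dec (P σ)) → Dec (∀ σ → P σ)
all? zero    P? = map′ (λ p → λ { [] → p }) (λ h → h []) (P? [])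
all? (suc n) P? =
  map′ (λ { (t , f) (true ∷ σ) → t σ ; (t , f) (false ∷ σ) → f σ })
       (λ h → (λ σ → h (true ∷ σ)) , (λ σ → h (false ∷ σ)))
       (all? n (λ σ → P? (true ∷ σ)) ×-dec all? n (λ σ → P? (false ∷ σ)))

tautology? : ∀ {n} (e₁ e₂ : Expr n) → Dec (Tautology e₁ e₂)
tautology? {n} e₁ e₂ = all? n (λ σ → ⟦ e₁ ⟧₂ σ ≟ ⟦ e₂ ⟧₂ σ)

-- The proof
-- is by induction on the number of variables, splitting on the first one
-- (Shannon expansion).
module Completeness {c ℓ} (B : BooleanAlgebra c ℓ) where
  open BooleanAlgebra B
  open BooleanAlgebraProperties B
  open Semantics B
  open SetoidReasoning setoid

  bool-homomorphism : ∀ {n} (e : Expr n) σ → ⟦ e ⟧ (map bool σ) ≈ bool (⟦ e ⟧₂ σ)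
  bool-homomorphism (var i)       σ = reflexive (lookup-map i bool σ)
  bool-homomorphism (const true)  σ = refl
  bool-homomorphism (const false) σ = refl
  bool-homomorphism (¬ᵉ e)        σ with ⟦ e ⟧₂ σ | bool-homomorphism e σ
  ... | true  | e≈ = trans (¬-cong e≈) ¬⊤≈⊥
  ... | false | e≈ = trans (¬-cong e≈) ¬⊥≈⊤
  bool-homomorphism (e ∧ᵉ f)      σ with ⟦ e ⟧₂ σ | bool-homomorphism e σ
  ... | true  | e≈ = trans (∧-cong e≈ refl) (trans (∧-identityˡ _) (bool-homomorphism f σ))
  ... | false | e≈ = trans (∧-cong e≈ refl) (∧-zeroˡ _)
  bool-homomorphism (e ∨ᵉ f)      σ with ⟦ e ⟧₂ σ | bool-homomorphism e σ
  ... | true  | e≈ = trans (∨-cong e≈ refl) (∨-zeroˡ _)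
  ... | false | e≈ = trans (∨-cong e≈ refl) (trans (∨-identityˡ _) (bool-homomorphism f σ))

  infix 4 _≈[_]_
  _≈[_]_ : Carrier → Carrier → Carrier → Set ℓ
  a ≈[ y ] b = y ∧ a ≈ y ∧ b

  ¬-below : ∀ y a → y ∧ ¬ a ≈ y ∧ ¬ (y ∧ a)
  ¬-below y a = begin
    y ∧ ¬ a                   ≈⟨ ∨-identityˡ (y ∧ ¬ a) ⟨
    ⊥ ∨ (y ∧ ¬ a)             ≈⟨ ∨-cong (∧-complementʳ y) refl ⟨
    (y ∧ ¬ y) ∨ (y ∧ ¬ a)     ≈⟨ ∧-distribˡ-∨ y (¬ y) (¬ a) ⟨
    y ∧ (¬ y ∨ ¬ a)           ≈⟨ ∧-cong refl (deMorgan₁ y a) ⟨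
    y ∧ ¬ (y ∧ a)             ∎

  ¬-cong-below : ∀ {y a b} → a ≈[ y ] b → ¬ a ≈[ y ] ¬ b
  ¬-cong-below {y} {a} {b} a≈b = begin
    y ∧ ¬ a         ≈⟨ ¬-below y a ⟩
    y ∧ ¬ (y ∧ a)   ≈⟨ ∧-cong refl (¬-cong a≈b) ⟩
    y ∧ ¬ (y ∧ b)   ≈⟨ ¬-below y b ⟨
    y ∧ ¬ b         ∎

  ∧-congˡ-below : ∀ {y a b} c → a ≈[ y ] b → a ∧ c ≈[ y ] b ∧ c
  ∧-congˡ-below {y} {a} {b} c a≈b = begin
    y ∧ (a ∧ c)     ≈⟨ ∧-assoc y a c ⟨
    (y ∧ a) ∧ c     ≈⟨ ∧-cong a≈b refl ⟩
    (y ∧ b) ∧ c     ≈⟨ ∧-assoc y b c ⟩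
    y ∧ (b ∧ c)     ∎

  ∧-cong-below : ∀ {y a b c d} → a ≈[ y ] b → c ≈[ y ] d → a ∧ c ≈[ y ] b ∧ d
  ∧-cong-below {y} {a} {b} {c} {d} a≈b c≈d = begin
    y ∧ (a ∧ c)     ≈⟨ ∧-congˡ-below c a≈b ⟩
    y ∧ (b ∧ c)     ≈⟨ ∧-cong refl (∧-comm b c) ⟩
    y ∧ (c ∧ b)     ≈⟨ ∧-congˡ-below b c≈d ⟩
    y ∧ (d ∧ b)     ≈⟨ ∧-cong refl (∧-comm d b) ⟩
    y ∧ (b ∧ d)     ∎

  ∨-cong-below : ∀ {y a b c d} → a ≈[ y ] b → c ≈[ y ] d → a ∨ c ≈[ y ] b ∨ d
  ∨-cong-below {y} {a} {b} {c} {d} a≈b c≈d = begin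
    y ∧ (a ∨ c)             ≈⟨ ∧-distribˡ-∨ y a c ⟩
    (y ∧ a) ∨ (y ∧ c)       ≈⟨ ∨-cong a≈b c≈d ⟩
    (y ∧ b) ∨ (y ∧ d)       ≈⟨ ∧-distribˡ-∨ y b d ⟨
    y ∧ (b ∨ d)             ∎

  ⟦⟧-cong-below : ∀ {n y x x'} (e : Expr (suc n)) (ρ : Vec Carrier n) →
                  x ≈[ y ] x' → ⟦ e ⟧ (x ∷ ρ) ≈[ y ] ⟦ e ⟧ (x' ∷ ρ)
  ⟦⟧-cong-below (var zero)    ρ x≈x' = x≈x'
  ⟦⟧-cong-below (var (suc i)) ρ x≈x' = refl
  ⟦⟧-cong-below (const b)     ρ x≈x' = refl
  ⟦⟧-cong-below (¬ᵉ e)        ρ x≈x' = ¬-cong-below (⟦⟧-cong-below e ρ x≈x')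
  ⟦⟧-cong-below (e ∧ᵉ f)      ρ x≈x' = ∧-cong-below (⟦⟧-cong-below e ρ x≈x') (⟦⟧-cong-below f ρ x≈x')
  ⟦⟧-cong-below (e ∨ᵉ f)      ρ x≈x' = ∨-cong-below (⟦⟧-cong-below e ρ x≈x') (⟦⟧-cong-below f ρ x≈x')

  shannon : ∀ x a → a ≈ (x ∧ a) ∨ (¬ x ∧ a)
  shannon x a = begin
    a                       ≈⟨ ∧-identityˡ a ⟨
    ⊤ ∧ a                   ≈⟨ ∧-cong (∨-complementʳ x) refl ⟨
    (x ∨ ¬ x) ∧ a           ≈⟨ ∧-distribʳ-∨ a x (¬ x) ⟩
    (x ∧ a) ∨ (¬ x ∧ a)     ∎

  truthTable-complete : ∀ {n} (e₁ e₂ : Expr n) → Tautology e₁ e₂ →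
                        ∀ ρ → ⟦ e₁ ⟧ ρ ≈ ⟦ e₂ ⟧ ρ
  truthTable-complete e₁ e₂ taut [] = begin
    ⟦ e₁ ⟧ []               ≈⟨ bool-homomorphism e₁ [] ⟩
    bool (⟦ e₁ ⟧₂ [])       ≡⟨ ≡.cong bool (taut []) ⟩
    bool (⟦ e₂ ⟧₂ [])       ≈⟨ bool-homomorphism e₂ [] ⟨
    ⟦ e₂ ⟧ []               ∎
  truthTable-complete e₁ e₂ taut (x ∷ ρ) = begin
    ⟦ e₁ ⟧ (x ∷ ρ)                                  ≈⟨ shannon x (⟦ e₁ ⟧ (x ∷ ρ)) ⟩
    (x ∧ ⟦ e₁ ⟧ (x ∷ ρ)) ∨ (¬ x ∧ ⟦ e₁ ⟧ (x ∷ ρ))   ≈⟨ ∨-cong (cofactor true x-below-x) (cofactor false x-below-¬x) ⟩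
    (x ∧ ⟦ e₂ ⟧ (x ∷ ρ)) ∨ (¬ x ∧ ⟦ e₂ ⟧ (x ∷ ρ))   ≈⟨ shannon x (⟦ e₂ ⟧ (x ∷ ρ)) ⟨
    ⟦ e₂ ⟧ (x ∷ ρ)                                  ∎
    where
    x-below-x : x ≈[ x ] ⊤
    x-below-x = trans (∧-idem x) (sym (∧-identityʳ x))
    x-below-¬x : x ≈[ ¬ x ] ⊥
    x-below-¬x = trans (∧-complementˡ x) (sym (∧-zeroʳ (¬ x)))
    -- Below y, x may be replaced by the constant b, turning both sides
    -- into expressions in fewer variables that are again tautologically equal.
    cofactor : ∀ {y} b → x ≈[ y ] bool b → ⟦ e₁ ⟧ (x ∷ ρ) ≈[ y ] ⟦ e₂ ⟧ (x ∷ ρ)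
    cofactor {y} b x≈b = begin
      y ∧ ⟦ e₁ ⟧ (x ∷ ρ)          ≈⟨ ⟦⟧-cong-below e₁ ρ x≈b ⟩
      y ∧ ⟦ e₁ ⟧ (bool b ∷ ρ)     ≡⟨ ≡.cong (y ∧_) (substitution e₁ (const b) ρ) ⟨
      y ∧ ⟦ e₁ [ const b ] ⟧ ρ    ≈⟨ ∧-cong refl (truthTable-complete (e₁ [ const b ]) (e₂ [ const b ]) cofactor-taut ρ) ⟩
      y ∧ ⟦ e₂ [ const b ] ⟧ ρ    ≡⟨ ≡.cong (y ∧_) (substitution e₂ (const b) ρ) ⟩
      y ∧ ⟦ e₂ ⟧ (bool b ∷ ρ)     ≈⟨ ⟦⟧-cong-below e₂ ρ x≈b ⟨
      y ∧ ⟦ e₂ ⟧ (x ∷ ρ)          ∎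
      where
      cofactor-taut : Tautology (e₁ [ const b ]) (e₂ [ const b ])
      cofactor-taut σ = ≡.trans (substitution₂ e₁ (const b) σ)
                          (≡.trans (taut (_ ∷ σ)) (≡.sym (substitution₂ e₂ (const b) σ)))

  byTruthTable : ∀ {n} (e₁ e₂ : Expr n) {_ : True (tautology? e₁ e₂)} →
                 ∀ ρ → ⟦ e₁ ⟧ ρ ≈ ⟦ e₂ ⟧ ρ
  byTruthTable e₁ e₂ {taut} = truthTable-complete e₁ e₂ (toWitness taut)

module EqSSCLAlgebra {A : Set} where
  open Defs using (refl; sym; trans)

  private
    _≋_ : Term A → Term A → Set
    _≋_ = EqSSCL⊢_≈_

  setoid : Setoid 0ℓ 0ℓ
  setoid = record { _≈_ = _≋_ ; isEquivalence = record { refl = refl ; sym = sym ; trans = trans } }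

  open SetoidReasoning setoid

  ∧-identityʳ : ∀ x → (x ∧ₛ 𝐓) ≋ x
  ∧-identityʳ x = trans (Comm x 𝐓) (Tand x)

  ∨-comm : ∀ x y → (x ∨ₛ y) ≋ (y ∨ₛ x)
  ∨-comm x y = trans (Or x y) (trans (cong¬ (Comm _ _)) (sym (Or y x)))

  ∨-zeroˡ : ∀ y → (𝐓 ∨ₛ y) ≋ 𝐓
  ∨-zeroˡ y = trans (sym (Tand _)) (Abs 𝐓 y)

  ∨-unfold : ∀ x y → (x ∨ₛ y) ≋ (((¬ₛ x) ∧ₛ y) ∨ₛ x)
  ∨-unfold x y = begin
    x ∨ₛ y                                    ≈⟨ ∧-identityʳ _ ⟨
    (x ∨ₛ y) ∧ₛ 𝐓                             ≈⟨ Mem x y 𝐓 ⟩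
    ((¬ₛ x) ∧ₛ (y ∧ₛ 𝐓)) ∨ₛ (x ∧ₛ 𝐓)          ≈⟨ cong∨ (cong∧ refl (∧-identityʳ y)) (∧-identityʳ x) ⟩
    ((¬ₛ x) ∧ₛ y) ∨ₛ x                        ∎

  𝐅-disjunct : ∀ y z → ((𝐅 ∧ₛ (y ∧ₛ z)) ∨ₛ z) ≋ z
  𝐅-disjunct y z = sym (begin
    z                                         ≈⟨ Tand z ⟨
    𝐓 ∧ₛ z                                    ≈⟨ cong∧ (∨-zeroˡ y) refl ⟨
    (𝐓 ∨ₛ y) ∧ₛ z                             ≈⟨ Mem 𝐓 y z ⟩
    ((¬ₛ 𝐓) ∧ₛ (y ∧ₛ z)) ∨ₛ (𝐓 ∧ₛ z)          ≈⟨ cong∨ (cong∧ (sym Neg) refl) (Tand z) ⟩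
    (𝐅 ∧ₛ (y ∧ₛ z)) ∨ₛ z                      ∎)

  ∧-idem : ∀ x → (x ∧ₛ x) ≋ x
  ∧-idem x = begin
    x ∧ₛ x                                    ≈⟨ cong∧ refl (𝐅-disjunct 𝐓 x) ⟨
    x ∧ₛ ((𝐅 ∧ₛ (𝐓 ∧ₛ x)) ∨ₛ x)               ≈⟨ cong∧ refl (∨-comm _ x) ⟩
    x ∧ₛ (x ∨ₛ (𝐅 ∧ₛ (𝐓 ∧ₛ x)))               ≈⟨ Abs x _ ⟩
    x                                         ∎

  ∨-idem : ∀ x → (x ∨ₛ x) ≋ x
  ∨-idem x = begin
    x ∨ₛ x                                    ≈⟨ ∨-unfold x x ⟩
    ((¬ₛ x) ∧ₛ x) ∨ₛ x                        ≈⟨ cong∨ (cong∧ refl (Tand x)) (∧-idem x) ⟨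
    ((¬ₛ x) ∧ₛ (𝐓 ∧ₛ x)) ∨ₛ (x ∧ₛ x)          ≈⟨ Mem x 𝐓 x ⟨
    (x ∨ₛ 𝐓) ∧ₛ x                             ≈⟨ Comm _ x ⟩
    x ∧ₛ (x ∨ₛ 𝐓)                             ≈⟨ Abs x 𝐓 ⟩
    x                                         ∎

  ¬-involutive : ∀ x → (¬ₛ (¬ₛ x)) ≋ x
  ¬-involutive x = begin
    ¬ₛ (¬ₛ x)                                 ≈⟨ cong¬ (∧-idem _) ⟨
    ¬ₛ ((¬ₛ x) ∧ₛ (¬ₛ x))                     ≈⟨ Or x x ⟨
    x ∨ₛ x                                    ≈⟨ ∨-idem x ⟩
    x                                         ∎

  ¬𝐅 : (¬ₛ 𝐅) ≋ 𝐓
  ¬𝐅 = trans (cong¬ Neg) (¬-involutive 𝐓)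

  deMorgan₂ : ∀ x y → (¬ₛ (x ∨ₛ y)) ≋ ((¬ₛ x) ∧ₛ (¬ₛ y))
  deMorgan₂ x y = trans (cong¬ (Or x y)) (¬-involutive _)

  deMorgan₁ : ∀ x y → (¬ₛ (x ∧ₛ y)) ≋ ((¬ₛ x) ∨ₛ (¬ₛ y))
  deMorgan₁ x y = begin
    ¬ₛ (x ∧ₛ y)                               ≈⟨ cong¬ (cong∧ (¬-involutive x) (¬-involutive y)) ⟨
    ¬ₛ ((¬ₛ (¬ₛ x)) ∧ₛ (¬ₛ (¬ₛ y)))           ≈⟨ Or _ _ ⟨
    (¬ₛ x) ∨ₛ (¬ₛ y)                          ∎

  ∨-identityˡ : ∀ y → (𝐅 ∨ₛ y) ≋ y
  ∨-identityˡ y = begin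
    𝐅 ∨ₛ y                                    ≈⟨ Or 𝐅 y ⟩
    ¬ₛ ((¬ₛ 𝐅) ∧ₛ (¬ₛ y))                     ≈⟨ cong¬ (trans (cong∧ ¬𝐅 refl) (Tand _)) ⟩
    ¬ₛ (¬ₛ y)                                 ≈⟨ ¬-involutive y ⟩
    y                                         ∎

  ∨-complementʳ : ∀ x → (x ∨ₛ (¬ₛ x)) ≋ 𝐓
  ∨-complementʳ x = begin
    x ∨ₛ (¬ₛ x)                               ≈⟨ ∨-comm _ _ ⟩
    (¬ₛ x) ∨ₛ x                               ≈⟨ cong∨ (trans (cong∧ refl (Tand 𝐓)) (∧-identityʳ _)) (∧-identityʳ x) ⟨
    ((¬ₛ x) ∧ₛ (𝐓 ∧ₛ 𝐓)) ∨ₛ (x ∧ₛ 𝐓)          ≈⟨ Mem x 𝐓 𝐓 ⟨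
    (x ∨ₛ 𝐓) ∧ₛ 𝐓                             ≈⟨ ∧-identityʳ _ ⟩
    x ∨ₛ 𝐓                                    ≈⟨ ∨-comm x 𝐓 ⟩
    𝐓 ∨ₛ x                                    ≈⟨ ∨-zeroˡ x ⟩
    𝐓                                         ∎

  ∧-complementʳ : ∀ x → (x ∧ₛ (¬ₛ x)) ≋ 𝐅
  ∧-complementʳ x = begin
    x ∧ₛ (¬ₛ x)                               ≈⟨ ¬-involutive _ ⟨
    ¬ₛ (¬ₛ (x ∧ₛ (¬ₛ x)))                     ≈⟨ cong¬ (deMorgan₁ x (¬ₛ x)) ⟩
    ¬ₛ ((¬ₛ x) ∨ₛ (¬ₛ (¬ₛ x)))                ≈⟨ cong¬ (∨-complementʳ (¬ₛ x)) ⟩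
    ¬ₛ 𝐓                                      ≈⟨ Neg ⟨
    𝐅                                         ∎

  ∧-zeroʳ : ∀ x → (x ∧ₛ 𝐅) ≋ 𝐅
  ∧-zeroʳ x = begin
    x ∧ₛ 𝐅                                    ≈⟨ ¬-involutive _ ⟨
    ¬ₛ (¬ₛ (x ∧ₛ 𝐅))                          ≈⟨ cong¬ (deMorgan₁ x 𝐅) ⟩
    ¬ₛ ((¬ₛ x) ∨ₛ (¬ₛ 𝐅))                     ≈⟨ cong¬ (cong∨ refl ¬𝐅) ⟩
    ¬ₛ ((¬ₛ x) ∨ₛ 𝐓)                          ≈⟨ cong¬ (trans (∨-comm _ 𝐓) (∨-zeroˡ _)) ⟩
    ¬ₛ 𝐓                                      ≈⟨ Neg ⟨
    𝐅                                         ∎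

  ∨-absorbs-∧ : ∀ x y → (x ∨ₛ (x ∧ₛ y)) ≋ x
  ∨-absorbs-∧ x y = begin
    x ∨ₛ (x ∧ₛ y)                             ≈⟨ ¬-involutive _ ⟨
    ¬ₛ (¬ₛ (x ∨ₛ (x ∧ₛ y)))                   ≈⟨ cong¬ (deMorgan₂ _ _) ⟩
    ¬ₛ ((¬ₛ x) ∧ₛ (¬ₛ (x ∧ₛ y)))              ≈⟨ cong¬ (cong∧ refl (deMorgan₁ x y)) ⟩
    ¬ₛ ((¬ₛ x) ∧ₛ ((¬ₛ x) ∨ₛ (¬ₛ y)))         ≈⟨ cong¬ (Abs _ _) ⟩
    ¬ₛ (¬ₛ x)                                 ≈⟨ ¬-involutive x ⟩
    x                                         ∎

  ∨-¬-∧ : ∀ a y → (((¬ₛ a) ∨ₛ y) ∧ₛ a) ≋ (y ∧ₛ a)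
  ∨-¬-∧ a y = begin
    ((¬ₛ a) ∨ₛ y) ∧ₛ a                        ≈⟨ cong∧ (∨-comm _ y) refl ⟩
    (y ∨ₛ (¬ₛ a)) ∧ₛ a                        ≈⟨ Mem y (¬ₛ a) a ⟩
    ((¬ₛ y) ∧ₛ ((¬ₛ a) ∧ₛ a)) ∨ₛ (y ∧ₛ a)     ≈⟨ cong∨ (cong∧ refl (trans (Comm _ a) (∧-complementʳ a))) refl ⟩
    ((¬ₛ y) ∧ₛ 𝐅) ∨ₛ (y ∧ₛ a)                 ≈⟨ cong∨ (∧-zeroʳ _) refl ⟩
    𝐅 ∨ₛ (y ∧ₛ a)                             ≈⟨ ∨-identityˡ _ ⟩
    y ∧ₛ a                                    ∎

  ∧-contradiction : ∀ a z → (a ∧ₛ ((¬ₛ a) ∧ₛ z)) ≋ 𝐅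
  ∧-contradiction a z = begin
    a ∧ₛ ((¬ₛ a) ∧ₛ z)                        ≈⟨ Comm _ _ ⟩
    ((¬ₛ a) ∧ₛ z) ∧ₛ a                        ≈⟨ ∨-¬-∧ a _ ⟨
    ((¬ₛ a) ∨ₛ ((¬ₛ a) ∧ₛ z)) ∧ₛ a            ≈⟨ cong∧ (∨-absorbs-∧ _ _) refl ⟩
    (¬ₛ a) ∧ₛ a                               ≈⟨ Comm _ _ ⟩
    a ∧ₛ (¬ₛ a)                               ≈⟨ ∧-complementʳ a ⟩
    𝐅                                         ∎

  ¬-∧-guard : ∀ x y z → ((¬ₛ (x ∧ₛ z)) ∧ₛ (y ∧ₛ z)) ≋ ((¬ₛ x) ∧ₛ (y ∧ₛ z))
  ¬-∧-guard x y z = begin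
    (¬ₛ (x ∧ₛ z)) ∧ₛ (y ∧ₛ z)                                         ≈⟨ cong∧ (deMorgan₁ x z) refl ⟩
    ((¬ₛ x) ∨ₛ (¬ₛ z)) ∧ₛ (y ∧ₛ z)                                    ≈⟨ Mem _ _ _ ⟩
    ((¬ₛ (¬ₛ x)) ∧ₛ ((¬ₛ z) ∧ₛ (y ∧ₛ z))) ∨ₛ ((¬ₛ x) ∧ₛ (y ∧ₛ z))     ≈⟨ cong∨ (trans (cong∧ refl ¬z∧y∧z) (∧-zeroʳ _)) refl ⟩
    𝐅 ∨ₛ ((¬ₛ x) ∧ₛ (y ∧ₛ z))                                         ≈⟨ ∨-identityˡ _ ⟩
    (¬ₛ x) ∧ₛ (y ∧ₛ z)                                                ∎
    where
    ¬z∧y∧z : ((¬ₛ z) ∧ₛ (y ∧ₛ z)) ≋ 𝐅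
    ¬z∧y∧z = trans (cong∧ refl (trans (Comm y z) (cong∧ (sym (¬-involutive z)) refl)))
                   (∧-contradiction (¬ₛ z) y)

  ∧-distribʳ-∨ : ∀ x y z → ((x ∨ₛ y) ∧ₛ z) ≋ ((x ∧ₛ z) ∨ₛ (y ∧ₛ z))
  ∧-distribʳ-∨ x y z = begin
    (x ∨ₛ y) ∧ₛ z                             ≈⟨ Mem x y z ⟩
    ((¬ₛ x) ∧ₛ (y ∧ₛ z)) ∨ₛ (x ∧ₛ z)          ≈⟨ cong∨ (¬-∧-guard x y z) refl ⟨
    ((¬ₛ (x ∧ₛ z)) ∧ₛ (y ∧ₛ z)) ∨ₛ (x ∧ₛ z)   ≈⟨ ∨-unfold _ _ ⟨
    (x ∧ₛ z) ∨ₛ (y ∧ₛ z)                      ∎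

  ∧-distribˡ-∨ : ∀ x y z → (x ∧ₛ (y ∨ₛ z)) ≋ ((x ∧ₛ y) ∨ₛ (x ∧ₛ z))
  ∧-distribˡ-∨ x y z = trans (Comm _ _) (trans (∧-distribʳ-∨ y z x) (cong∨ (Comm _ _) (Comm _ _)))

  algebra : MinimalBooleanAlgebra 0ℓ 0ℓ
  algebra = record
    { Carrier       = Term A
    ; _≈_           = _≋_
    ; _∨_           = _∨ₛ_
    ; _∧_           = _∧ₛ_
    ; ¬_            = ¬ₛ_
    ; ⊤             = 𝐓
    ; ⊥             = 𝐅
    ; isEquivalence = Setoid.isEquivalence setoid
    ; ∨-cong        = cong∨
    ; ∧-cong        = cong∧
    ; ¬-cong        = cong¬
    ; ∧-comm        = Comm
    ; ∧-distribˡ-∨  = ∧-distribˡ-∨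
    ; ∧-identityʳ   = ∧-identityʳ
    ; ∧-complementʳ = ∧-complementʳ
    ; ¬-involutive  = ¬-involutive
    ; deMorgan₂     = deMorgan₂
    }

module SSCLAlgebra {A : Set} where
  open Defs using (refl; sym; trans)

  private
    _≋_ : CTerm A → CTerm A → Set
    _≋_ = SSCL⊢_≈_

  setoid : Setoid 0ℓ 0ℓ
  setoid = record { _≈_ = _≋_ ; isEquivalence = record { refl = refl ; sym = sym ; trans = trans } }

  open SetoidReasoning setoid

  not : CTerm A → CTerm A
  not x = 𝐅 ◁ x ▷ 𝐓

  ◁-not : ∀ x y z → (y ◁ not x ▷ z) ≋ (z ◁ x ▷ y)
  ◁-not x y z = trans (CP4 y 𝐅 x 𝐓 z) (cong◁▷ (CP2 y z) refl (CP1 y z))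

  not-involutive : ∀ x → not (not x) ≋ x
  not-involutive x = trans (◁-not x 𝐅 𝐓) (CP3 x)

  -- Once the condition y has been evaluated, a repeated test of y in the
  -- right branch takes its right branch (CPmem), and dually for the left.
  ◁-repeatʳ : ∀ a y v w → (a ◁ y ▷ (v ◁ y ▷ w)) ≋ (a ◁ y ▷ w)
  ◁-repeatʳ a y v w = begin
    a ◁ y ▷ (v ◁ y ▷ w)                 ≈⟨ cong◁▷ refl refl (CP2 𝐅 _) ⟨
    a ◁ y ▷ (𝐅 ◁ 𝐅 ▷ (v ◁ y ▷ w))       ≈⟨ CPmem a y 𝐅 𝐅 v w ⟩
    a ◁ y ▷ (𝐅 ◁ 𝐅 ▷ w)                 ≈⟨ cong◁▷ refl refl (CP2 𝐅 w) ⟩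
    a ◁ y ▷ w                           ∎

  ◁-repeatˡ : ∀ a b y w → ((a ◁ y ▷ b) ◁ y ▷ w) ≋ (a ◁ y ▷ w)
  ◁-repeatˡ a b y w = begin
    (a ◁ y ▷ b) ◁ y ▷ w                 ≈⟨ ◁-not y w _ ⟨
    w ◁ not y ▷ (a ◁ y ▷ b)             ≈⟨ cong◁▷ refl refl (◁-not y b a) ⟨
    w ◁ not y ▷ (b ◁ not y ▷ a)         ≈⟨ ◁-repeatʳ _ _ _ _ ⟩
    w ◁ not y ▷ a                       ≈⟨ ◁-not y w a ⟩
    a ◁ y ▷ w                           ∎

  ◁-idem : ∀ t x → (t ◁ x ▷ t) ≋ t
  ◁-idem t x = begin
    t ◁ x ▷ t                           ≈⟨ cong◁▷ (CP1 t t) refl (CP1 t t) ⟨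
    (t ◁ 𝐓 ▷ t) ◁ x ▷ (t ◁ 𝐓 ▷ t)       ≈⟨ CP4 t 𝐓 x 𝐓 t ⟨
    t ◁ (𝐓 ◁ x ▷ 𝐓) ▷ t                 ≈⟨ cong◁▷ refl 𝐓◁x▷𝐓 refl ⟩
    t ◁ 𝐓 ▷ t                           ≈⟨ CP1 t t ⟩
    t                                   ∎
    where
    𝐓◁x▷𝐓 : (𝐓 ◁ x ▷ 𝐓) ≋ 𝐓
    𝐓◁x▷𝐓 = begin
      𝐓 ◁ x ▷ 𝐓                         ≈⟨ cong◁▷ (CP2 𝐅 𝐓) refl (CP2 𝐅 𝐓) ⟨
      (𝐅 ◁ 𝐅 ▷ 𝐓) ◁ x ▷ (𝐅 ◁ 𝐅 ▷ 𝐓)     ≈⟨ CP4 𝐅 𝐅 x 𝐅 𝐓 ⟨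
      𝐅 ◁ (𝐅 ◁ x ▷ 𝐅) ▷ 𝐓               ≈⟨ cong◁▷ refl (CPs x) refl ⟩
      𝐅 ◁ 𝐅 ▷ 𝐓                         ≈⟨ CP2 𝐅 𝐓 ⟩
      𝐓                                 ∎

  ◁𝐅-comm : ∀ x y → (x ◁ y ▷ 𝐅) ≋ (y ◁ x ▷ 𝐅)
  ◁𝐅-comm x y = begin
    x ◁ y ▷ 𝐅                                         ≈⟨ ◁-idem _ x ⟨
    (x ◁ y ▷ 𝐅) ◁ x ▷ (x ◁ y ▷ 𝐅)                     ≈⟨ cong◁▷ refl refl (◁-not y 𝐅 x) ⟨
    (x ◁ y ▷ 𝐅) ◁ x ▷ (𝐅 ◁ not y ▷ x)                 ≈⟨ cong◁▷ refl refl (cong◁▷ refl refl (CP3 x)) ⟨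
    (x ◁ y ▷ 𝐅) ◁ x ▷ (𝐅 ◁ not y ▷ (𝐓 ◁ x ▷ 𝐅))       ≈⟨ CPmem _ x 𝐅 (not y) 𝐓 𝐅 ⟩
    (x ◁ y ▷ 𝐅) ◁ x ▷ (𝐅 ◁ not y ▷ 𝐅)                 ≈⟨ cong◁▷ refl refl (CPs _) ⟩
    (x ◁ y ▷ 𝐅) ◁ x ▷ 𝐅                               ≈⟨ ◁-not x 𝐅 _ ⟨
    𝐅 ◁ not x ▷ (x ◁ y ▷ 𝐅)                           ≈⟨ cong◁▷ refl refl (◁-not y 𝐅 x) ⟨
    𝐅 ◁ not x ▷ (𝐅 ◁ not y ▷ x)                       ≈⟨ cong◁▷ refl refl (cong◁▷ refl refl (not-involutive x)) ⟨
    𝐅 ◁ not x ▷ (𝐅 ◁ not y ▷ (𝐅 ◁ not x ▷ 𝐓))         ≈⟨ CPmem 𝐅 (not x) 𝐅 (not y) 𝐅 𝐓 ⟩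
    𝐅 ◁ not x ▷ (𝐅 ◁ not y ▷ 𝐓)                       ≈⟨ cong◁▷ refl refl (not-involutive y) ⟩
    𝐅 ◁ not x ▷ y                                     ≈⟨ ◁-not x 𝐅 y ⟩
    y ◁ x ▷ 𝐅                                         ∎

  ∧-comm : ∀ x y → (x ∧ₛ y) ≋ (y ∧ₛ x)
  ∧-comm x y = trans (Def∧ x y) (trans (◁𝐅-comm y x) (sym (Def∧ y x)))

  ∧-distribˡ-∨ : ∀ x y z → (x ∧ₛ (y ∨ₛ z)) ≋ ((x ∧ₛ y) ∨ₛ (x ∧ₛ z))
  ∧-distribˡ-∨ x y z = begin
    x ∧ₛ (y ∨ₛ z)                       ≈⟨ Def∧ _ _ ⟩
    (y ∨ₛ z) ◁ x ▷ 𝐅                    ≈⟨ cong◁▷ (Def∨ y z) refl refl ⟩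
    (𝐓 ◁ y ▷ z) ◁ x ▷ 𝐅                 ≈⟨ ◁-not x 𝐅 _ ⟨
    𝐅 ◁ not x ▷ (𝐓 ◁ y ▷ z)             ≈⟨ CPmem 𝐅 (not x) 𝐓 y 𝐅 z ⟨
    𝐅 ◁ not x ▷ (𝐓 ◁ y ▷ (𝐅 ◁ not x ▷ z)) ≈⟨ ◁-not x 𝐅 _ ⟩
    (𝐓 ◁ y ▷ (𝐅 ◁ not x ▷ z)) ◁ x ▷ 𝐅   ≈⟨ cong◁▷ (cong◁▷ refl refl (◁-not x 𝐅 z)) refl refl ⟩
    (𝐓 ◁ y ▷ x∧z) ◁ x ▷ 𝐅               ≈⟨ ◁-repeatʳ _ x z 𝐅 ⟨
    (𝐓 ◁ y ▷ x∧z) ◁ x ▷ x∧z             ≈⟨ cong◁▷ refl refl (CP2 𝐓 x∧z) ⟨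
    (𝐓 ◁ y ▷ x∧z) ◁ x ▷ (𝐓 ◁ 𝐅 ▷ x∧z)   ≈⟨ CP4 𝐓 y x 𝐅 x∧z ⟨
    𝐓 ◁ (y ◁ x ▷ 𝐅) ▷ x∧z               ≈⟨ cong◁▷ refl (Def∧ x y) (Def∧ x z) ⟨
    𝐓 ◁ (x ∧ₛ y) ▷ (x ∧ₛ z)             ≈⟨ Def∨ _ _ ⟨
    (x ∧ₛ y) ∨ₛ (x ∧ₛ z)                ∎
    where
    x∧z = z ◁ x ▷ 𝐅

  ∧-identityʳ : ∀ x → (x ∧ₛ 𝐓) ≋ x
  ∧-identityʳ x = trans (Def∧ x 𝐓) (CP3 x)

  ∧-complementʳ : ∀ x → (x ∧ₛ (¬ₛ x)) ≋ 𝐅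
  ∧-complementʳ x = begin
    x ∧ₛ (¬ₛ x)                         ≈⟨ Def∧ _ _ ⟩
    (¬ₛ x) ◁ x ▷ 𝐅                      ≈⟨ cong◁▷ (Def¬ x) refl refl ⟩
    (𝐅 ◁ x ▷ 𝐓) ◁ x ▷ 𝐅                 ≈⟨ ◁-repeatˡ _ _ _ _ ⟩
    𝐅 ◁ x ▷ 𝐅                           ≈⟨ CPs x ⟩
    𝐅                                   ∎

  ¬-involutive : ∀ x → (¬ₛ (¬ₛ x)) ≋ x
  ¬-involutive x = trans (Def¬ _) (trans (cong◁▷ refl (Def¬ x) refl) (not-involutive x))

  deMorgan₂ : ∀ x y → (¬ₛ (x ∨ₛ y)) ≋ ((¬ₛ x) ∧ₛ (¬ₛ y))
  deMorgan₂ x y = begin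
    ¬ₛ (x ∨ₛ y)                         ≈⟨ Def¬ _ ⟩
    𝐅 ◁ (x ∨ₛ y) ▷ 𝐓                    ≈⟨ cong◁▷ refl (Def∨ x y) refl ⟩
    𝐅 ◁ (𝐓 ◁ x ▷ y) ▷ 𝐓                 ≈⟨ CP4 𝐅 𝐓 x y 𝐓 ⟩
    (𝐅 ◁ 𝐓 ▷ 𝐓) ◁ x ▷ not y             ≈⟨ cong◁▷ (CP1 𝐅 𝐓) refl refl ⟩
    𝐅 ◁ x ▷ not y                       ≈⟨ ◁-not x (not y) 𝐅 ⟨
    not y ◁ not x ▷ 𝐅                   ≈⟨ cong◁▷ (Def¬ y) (Def¬ x) refl ⟨
    (¬ₛ y) ◁ (¬ₛ x) ▷ 𝐅                 ≈⟨ Def∧ _ _ ⟨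
    (¬ₛ x) ∧ₛ (¬ₛ y)                    ∎

  algebra : MinimalBooleanAlgebra 0ℓ 0ℓ
  algebra = record
    { Carrier       = CTerm A
    ; _≈_           = _≋_
    ; _∨_           = _∨ₛ_
    ; _∧_           = _∧ₛ_
    ; ¬_            = ¬ₛ_
    ; ⊤             = 𝐓
    ; ⊥             = 𝐅
    ; isEquivalence = Setoid.isEquivalence setoid
    ; ∨-cong        = cong∨
    ; ∧-cong        = cong∧
    ; ¬-cong        = cong¬
    ; ∧-comm        = ∧-comm
    ; ∧-distribˡ-∨  = ∧-distribˡ-∨
    ; ∧-identityʳ   = ∧-identityʳ
    ; ∧-complementʳ = ∧-complementʳ
    ; ¬-involutive  = ¬-involutive
    ; deMorgan₂     = deMorgan₂
    }

v₀ : ∀ {n} → Expr (1 + n)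
v₀ = var zero
v₁ : ∀ {n} → Expr (2 + n)
v₁ = var (suc zero)
v₂ : ∀ {n} → Expr (3 + n)
v₂ = var (suc (suc zero))
v₃ : ∀ {n} → Expr (4 + n)
v₃ = var (suc (suc (suc zero)))
v₄ : ∀ {n} → Expr (5 + n)
v₄ = var (suc (suc (suc (suc zero))))
v₅ : ∀ {n} → Expr (6 + n)
v₅ = var (suc (suc (suc (suc (suc zero)))))

_◁ᵉ_▷ᵉ_ : ∀ {n} → Expr n → Expr n → Expr n → Expr n
a ◁ᵉ c ▷ᵉ b = (c ∧ᵉ a) ∨ᵉ (¬ᵉ c ∧ᵉ b)

eliminate : {A : Set} → CTerm A → Term A
eliminate (var n)     = var n
eliminate (atom a)    = atom a
eliminate 𝐓           = 𝐓
eliminate 𝐅           = 𝐅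
eliminate (¬ₛ x)      = ¬ₛ eliminate x
eliminate (x ∧ₛ y)    = eliminate x ∧ₛ eliminate y
eliminate (x ∨ₛ y)    = eliminate x ∨ₛ eliminate y
eliminate (x ◁ y ▷ z) = (eliminate y ∧ₛ eliminate x) ∨ₛ ((¬ₛ eliminate y) ∧ₛ eliminate z)

eliminate-emb : {A : Set} (s : Term A) → eliminate (emb s) ≡ s
eliminate-emb (var n)  = ≡.refl
eliminate-emb (atom a) = ≡.refl
eliminate-emb 𝐓        = ≡.refl
eliminate-emb 𝐅        = ≡.refl
eliminate-emb (¬ₛ s)   = ≡.cong ¬ₛ_ (eliminate-emb s)
eliminate-emb (s ∧ₛ t) = ≡.cong₂ _∧ₛ_ (eliminate-emb s) (eliminate-emb t)
eliminate-emb (s ∨ₛ t) = ≡.cong₂ _∨ₛ_ (eliminate-emb s) (eliminate-emb t)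

module _ {A : Set} where
  open Defs using (refl; sym; trans)

  module EqSSCL = Completeness (booleanAlgebra (EqSSCLAlgebra.algebra {A}))
  module SSCL   = Completeness (booleanAlgebra (SSCLAlgebra.algebra {A}))

  -- Each SSCL axiom becomes, after eliminating the conditional, an
  -- identity of Boolean algebra, hence an EqSSCL-theorem.
  eliminate-sound : {a b : CTerm A} → SSCL⊢ a ≈ b → EqSSCL⊢ eliminate a ≈ eliminate b
  eliminate-sound (CP1 x y) =
    EqSSCL.byTruthTable (v₀ ◁ᵉ ⊤ᵉ ▷ᵉ v₁) v₀ (eliminate x ∷ eliminate y ∷ [])
  eliminate-sound (CP2 x y) =
    EqSSCL.byTruthTable (v₀ ◁ᵉ ⊥ᵉ ▷ᵉ v₁) v₁ (eliminate x ∷ eliminate y ∷ [])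
  eliminate-sound (CP3 x) =
    EqSSCL.byTruthTable (⊤ᵉ ◁ᵉ v₀ ▷ᵉ ⊥ᵉ) v₀ (eliminate x ∷ [])
  eliminate-sound (CP4 x y z u v) =
    EqSSCL.byTruthTable (v₀ ◁ᵉ (v₁ ◁ᵉ v₂ ▷ᵉ v₃) ▷ᵉ v₄) ((v₀ ◁ᵉ v₁ ▷ᵉ v₄) ◁ᵉ v₂ ▷ᵉ (v₀ ◁ᵉ v₃ ▷ᵉ v₄))
      (eliminate x ∷ eliminate y ∷ eliminate z ∷ eliminate u ∷ eliminate v ∷ [])
  eliminate-sound (CPmem x y z u v w) =
    EqSSCL.byTruthTable (v₀ ◁ᵉ v₁ ▷ᵉ (v₂ ◁ᵉ v₃ ▷ᵉ (v₄ ◁ᵉ v₁ ▷ᵉ v₅))) (v₀ ◁ᵉ v₁ ▷ᵉ (v₂ ◁ᵉ v₃ ▷ᵉ v₅))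
      (eliminate x ∷ eliminate y ∷ eliminate z ∷ eliminate u ∷ eliminate v ∷ eliminate w ∷ [])
  eliminate-sound (CPs x) =
    EqSSCL.byTruthTable (⊥ᵉ ◁ᵉ v₀ ▷ᵉ ⊥ᵉ) ⊥ᵉ (eliminate x ∷ [])
  eliminate-sound (Def¬ x) =
    EqSSCL.byTruthTable (¬ᵉ v₀) (⊥ᵉ ◁ᵉ v₀ ▷ᵉ ⊤ᵉ) (eliminate x ∷ [])
  eliminate-sound (Def∧ x y) =
    EqSSCL.byTruthTable (v₀ ∧ᵉ v₁) (v₁ ◁ᵉ v₀ ▷ᵉ ⊥ᵉ) (eliminate x ∷ eliminate y ∷ [])
  eliminate-sound (Def∨ x y) =
    EqSSCL.byTruthTable (v₀ ∨ᵉ v₁) (⊤ᵉ ◁ᵉ v₀ ▷ᵉ v₁) (eliminate x ∷ eliminate y ∷ [])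
  eliminate-sound refl        = refl
  eliminate-sound (sym p)     = sym (eliminate-sound p)
  eliminate-sound (trans p q) = trans (eliminate-sound p) (eliminate-sound q)
  eliminate-sound (cong¬ p)   = cong¬ (eliminate-sound p)
  eliminate-sound (cong∧ p q) = cong∧ (eliminate-sound p) (eliminate-sound q)
  eliminate-sound (cong∨ p q) = cong∨ (eliminate-sound p) (eliminate-sound q)
  eliminate-sound (cong◁▷ p q r) =
    cong∨ (cong∧ (eliminate-sound q) (eliminate-sound p)) (cong∧ (cong¬ (eliminate-sound q)) (eliminate-sound r))

  -- Each EqSSCL axiom is an identity of Boolean algebra, hence an SSCL-theorem.
  emb-sound : {s t : Term A} → EqSSCL⊢ s ≈ t → SSCL⊢ emb s ≈ emb t
  emb-sound Neg =
    SSCL.byTruthTable ⊥ᵉ (¬ᵉ ⊤ᵉ) []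
  emb-sound (Or x y) =
    SSCL.byTruthTable (v₀ ∨ᵉ v₁) (¬ᵉ (¬ᵉ v₀ ∧ᵉ ¬ᵉ v₁)) (emb x ∷ emb y ∷ [])
  emb-sound (Tand x) =
    SSCL.byTruthTable (⊤ᵉ ∧ᵉ v₀) v₀ (emb x ∷ [])
  emb-sound (Abs x y) =
    SSCL.byTruthTable (v₀ ∧ᵉ (v₀ ∨ᵉ v₁)) v₀ (emb x ∷ emb y ∷ [])
  emb-sound (Mem x y z) =
    SSCL.byTruthTable ((v₀ ∨ᵉ v₁) ∧ᵉ v₂) ((¬ᵉ v₀ ∧ᵉ (v₁ ∧ᵉ v₂)) ∨ᵉ (v₀ ∧ᵉ v₂)) (emb x ∷ emb y ∷ emb z ∷ [])
  emb-sound (Comm x y) =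
    SSCL.byTruthTable (v₀ ∧ᵉ v₁) (v₁ ∧ᵉ v₀) (emb x ∷ emb y ∷ [])
  emb-sound refl        = refl
  emb-sound (sym p)     = sym (emb-sound p)
  emb-sound (trans p q) = trans (emb-sound p) (emb-sound q)
  emb-sound (cong¬ p)   = cong¬ (emb-sound p)
  emb-sound (cong∧ p q) = cong∧ (emb-sound p) (emb-sound q)
  emb-sound (cong∨ p q) = cong∨ (emb-sound p) (emb-sound q)

theorem6p5 : {A : Set} → A → (s t : Term A) →
    ((EqSSCL⊢ s ≈ t → SSCL⊢ emb s ≈ emb t) × (SSCL⊢ emb s ≈ emb t → EqSSCL⊢ s ≈ t))
theorem6p5 _ s t = emb-sound , λ p → ≡.subst₂ EqSSCL⊢_≈_ (eliminate-emb s) (eliminate-emb t) (eliminate-sound p)
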